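{- Let $G=(V,E)$ be an undirected graph and $W\subseteq V$. Let $H$ be the graph with vertex set $\{v_e: e\in E\}\cup\{w': w\in W\}$ (the $w'$ being new vertices) in which $v_e$ and $v_f$ ($e\neq f$) are adjacent iff the edges $e$ and $f$ share an end vertex in $G$, and $w'$ is adjacent to $v_e$ iff $e$ is incident to $w$ in $G$ (no other edges). Let $W_H=\{w':w\in W\}$. For a subgraph $T$ of $G$, let $V_T=\{v_e: e\in E(T)\}$. Then $T$ is a Steiner subgraph of $(G,W)$ if and only if $H[V_T\cup W_H]$ is an induced Steiner subgraph of $(H,W_H)$.
   Context: A Steiner subgraph of $(G,W)$ is a subgraph of $G$ containing a path between every pair of vertices of $W$. An induced Steiner subgraph of $(H,W_H)$ is an induced subgraph of $H$ containing a path between every pair of vertices of $W_H$. -}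

module Defs where

open import Data.Nat using (ℕ)
open import Data.Bool using (Bool; T)
open import Data.Fin using (Fin; _<_)
open import Data.Fin.Subset using (Subset; _∈_)
open import Data.List using (List; []; _∷_)
open import Data.List.Relation.Unary.Unique.Propositional using (Unique)
open import Data.Product using (Σ; _×_; _,_; proj₁; proj₂; ∃)
open import Data.Sum using (_⊎_; inj₁; inj₂)
open import Data.Unit using (⊤)
open import Data.Empty using (⊥)
open import Relation.Nullary using (¬_)
open import Relation.Binary.PropositionalEquality using (_≡_)

record Graph : Set₁ where
  field
    V   : Set
    Adj : V → V → Set
open Graph public

data Walk (Γ : Graph) : V Γ → V Γ → List (V Γ) → Set where
  here : ∀ {x} → Walk Γ x x (x ∷ [])
  step : ∀ {x y z vs} → Adj Γ x y → Walk Γ y z vs → Walk Γ x z (x ∷ vs)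

Path : (Γ : Graph) → V Γ → V Γ → Set
Path Γ x y = Σ (List (V Γ)) λ vs → Walk Γ x y vs × Unique vs

record SimpleGraph (n : ℕ) : Set where
  field
    adj     : Fin n → Fin n → Bool
    adj-sym : ∀ u v → adj u v ≡ adj v u
    irrefl  : ∀ u → ¬ T (adj u u)
open SimpleGraph public

-- an edge {u,v} represented by its endpoints ordered as u < v
Edge : ∀ {n} → SimpleGraph n → Set
Edge {n} G = Σ (Fin n × Fin n) λ p → (proj₁ p < proj₂ p) × T (adj G (proj₁ p) (proj₂ p))

ends : ∀ {n} {G : SimpleGraph n} → Edge G → Fin n × Fin n
ends = proj₁


Incident : ∀ {n} {G : SimpleGraph n} → Fin n → Edge G → Set
Incident w e = (proj₁ (proj₁ e) ≡ w) ⊎ (proj₂ (proj₁ e) ≡ w)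

ShareEnd : ∀ {n} {G : SimpleGraph n} → Edge G → Edge G → Set
ShareEnd {n} {G} e f = Σ (Fin n) λ v → Incident {G = G} v e × Incident {G = G} v f

record Subgraph {n} (G : SimpleGraph n) : Set₁ where
  field
    TV     : Fin n → Set
    TE     : Edge G → Set
    closed : ∀ e → TE e → TV (proj₁ (proj₁ e)) × TV (proj₂ (proj₁ e))
open Subgraph public

asGraph : ∀ {n} {G : SimpleGraph n} → Subgraph G → Graph
asGraph {n} {G} T = record
  { V   = Σ (Fin n) (TV T)
  ; Adj = λ x y → Σ (Edge G) λ e → TE T e ×
            ((proj₁ e ≡ (proj₁ x , proj₁ y)) ⊎ (proj₁ e ≡ (proj₁ y , proj₁ x)))
  }

IsSteiner : ∀ {n} (G : SimpleGraph n) (W : Subset n) → Subgraph G → Set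
IsSteiner {n} G W T =
  ∀ (u v : Fin n) → u ∈ W → v ∈ W → ¬ (u ≡ v) →
  Σ (TV T u) λ tu → Σ (TV T v) λ tv → Path (asGraph T) (u , tu) (v , tv)

WVert : ∀ {n} → Subset n → Set
WVert {n} W = Σ (Fin n) (_∈ W)

HV : ∀ {n} → SimpleGraph n → Subset n → Set
HV G W = Edge G ⊎ WVert W

HAdj : ∀ {n} (G : SimpleGraph n) (W : Subset n) → HV G W → HV G W → Set
HAdj G W (inj₁ e) (inj₁ f) = ¬ (proj₁ e ≡ proj₁ f) × ShareEnd {G = G} e f
HAdj G W (inj₁ e) (inj₂ w) = Incident {G = G} (proj₁ w) e
HAdj G W (inj₂ w) (inj₁ e) = Incident {G = G} (proj₁ w) e
HAdj G W (inj₂ w) (inj₂ w₁) = ⊥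

H : ∀ {n} (G : SimpleGraph n) (W : Subset n) → Graph
H G W = record { V = HV G W ; Adj = HAdj G W }

Induced : (Γ : Graph) → (V Γ → Set) → Graph
Induced Γ S = record
  { V   = Σ (V Γ) S
  ; Adj = λ x y → Adj Γ (proj₁ x) (proj₁ y) }

VT∪WH : ∀ {n} {G : SimpleGraph n} {W : Subset n} → Subgraph G → HV G W → Set
VT∪WH T (inj₁ e) = TE T e
VT∪WH T (inj₂ w) = ⊤

IsInducedSteiner : (Γ : Graph) (WH : V Γ → Set) (S : V Γ → Set) → Set
IsInducedSteiner Γ WH S =
  ∀ (x y : V Γ) → WH x → WH y → ¬ (x ≡ y) →
  Σ (S x) λ sx → Σ (S y) λ sy → Path (Induced Γ S) (x , sx) (y , sy)

WH : ∀ {n} {G : SimpleGraph n} {W : Subset n} → HV G W → Set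
WH (inj₁ _) = ⊥
WH (inj₂ _) = ⊤

-- A walk in T from u to v becomes a walk in H[V_T ∪ W_H] from u' to v' through
-- the vertices v_e of the edges e it traverses: consecutive distinct edges of
-- the walk share an end, and the first and last edges are incident to u and v.
-- Conversely, along a walk in H[V_T ∪ W_H] from u' to v' every vertex v_e has
-- e ∈ E(T), and consecutive vertices share an end vertex in G, so following the
-- edges e inside T joins u to v. In both directions a walk is then shortened
-- to a path by cutting out the segment between two visits of the same vertex.
module Submission where

open import Data.Fin using (Fin; _≟_)
open import Data.Fin.Subset using (Subset; _∈_)
open import Data.List using (List; []; _∷_; map)
open import Data.List.Membership.Propositional using () renaming (_∈_ to _∈ₗ_)
open import Data.List.Relation.Unary.Any using (here; there; any?)
open import Data.List.Relation.Unary.All using ([])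
open import Data.List.Relation.Unary.All.Properties.Core using (¬Any⇒All¬)
open import Data.List.Relation.Unary.AllPairs using ([]; _∷_)
open import Data.List.Relation.Unary.Unique.Propositional using (Unique)
open import Data.List.Relation.Unary.Unique.Propositional.Properties using (map⁻)
open import Data.Product using (Σ; _×_; _,_; proj₁; proj₂)
import Data.Product.Properties as Product
open import Data.Sum using (_⊎_; inj₁; inj₂)
import Data.Sum as Sum
import Data.Sum.Properties as Sum
open import Data.Unit using (tt)
open import Data.Empty using (⊥-elim)
open import Data.Vec.Properties.WithK using ([]=-irrelevant)
open import Function using (_∘_)
open import Function.Bundles using (_⇔_; mk⇔)
open import Relation.Binary.Definitions using (DecidableEquality)
open import Relation.Binary.PropositionalEquality using (_≡_; refl; sym; cong)
open import Relation.Nullary using (¬_; yes; no)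
open import Defs

Reachable : (Γ : Graph) → V Γ → V Γ → Set
Reachable Γ x y = Σ (List (V Γ)) (Walk Γ x y)

reachable-refl : ∀ {Γ x} → Reachable Γ x x
reachable-refl = _ , here

reachable-trans : ∀ {Γ x y z} → Reachable Γ x y → Reachable Γ y z → Reachable Γ x z
reachable-trans (_ , here)       r = r
reachable-trans (_ , step a w)   r = _ , step a (proj₂ (reachable-trans (_ , w) r))

-- Vertices of the graphs below carry proofs that need not be unique, so walks
-- are shortened with respect to a key with decidable equality on which
-- adjacency depends; the start of the path is then only determined by its key.
module WalkToPath {Γ : Graph} {A : Set} (key : V Γ → A) (_≟ᴬ_ : DecidableEquality A)
  (Adj-respʳ : ∀ {x y y′} → key y ≡ key y′ → Adj Γ x y → Adj Γ x y′) where

  KeyPath : V Γ → V Γ → Set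
  KeyPath x z = Σ (List (V Γ)) λ vs → Walk Γ x z vs × Unique (map key vs)

  keyPath-suffix : ∀ {k y z vs} → Walk Γ y z vs → Unique (map key vs) → k ∈ₗ map key vs →
                   Σ (V Γ) λ y′ → key y′ ≡ k × KeyPath y′ z
  keyPath-suffix here         u       (here k≡y) = _ , sym k≡y , _ , here , u
  keyPath-suffix (step a w)   u       (here k≡y) = _ , sym k≡y , _ , step a w , u
  keyPath-suffix (step _ w)   (_ ∷ u) (there k∈) = keyPath-suffix w u k∈

  walk⇒keyPath : ∀ {x z vs} → Walk Γ x z vs → Σ (V Γ) λ x′ → key x′ ≡ key x × KeyPath x′ z
  walk⇒keyPath here = _ , refl , _ , here , [] ∷ []
  walk⇒keyPath {x} (step adj w) with walk⇒keyPath w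
  ... | y′ , y′≡y , ws , w′ , u with any? (key x ≟ᴬ_) (map key ws)
  ...   | yes x∈ = keyPath-suffix w′ u x∈
  ...   | no  x∉ = x , refl , _ , step (Adj-respʳ (sym y′≡y) adj) w′ , ¬Any⇒All¬ _ x∉ ∷ u

  walk⇒path : ∀ {x z vs} → Walk Γ x z vs → Σ (V Γ) λ x′ → key x′ ≡ key x × Path Γ x′ z
  walk⇒path w with walk⇒keyPath w
  ... | x′ , x′≡x , ws , w′ , u = x′ , x′≡x , ws , w′ , map⁻ u

module _ {n} (G : SimpleGraph n) where

  infix 4 _∈ᵉ_
  _∈ᵉ_ : Fin n → Edge G → Set
  a ∈ᵉ e = Incident {G = G} a e

  ∈ᵉ-resp : ∀ {a} (e f : Edge G) → proj₁ e ≡ proj₁ f → a ∈ᵉ e → a ∈ᵉ f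
  ∈ᵉ-resp (p , _) (.p , _) refl a∈e = a∈e

  ends-∈ᵉ : ∀ {a b} (e : Edge G) → (proj₁ e ≡ (a , b)) ⊎ (proj₁ e ≡ (b , a)) →
           a ∈ᵉ e × b ∈ᵉ e
  ends-∈ᵉ e (inj₁ refl) = inj₁ refl , inj₂ refl
  ends-∈ᵉ e (inj₂ refl) = inj₂ refl , inj₁ refl

  module _ (W : Subset n) where

    hkey : HV G W → (Fin n × Fin n) ⊎ Fin n
    hkey = Sum.map proj₁ proj₁

    _≟ʰ_ : DecidableEquality ((Fin n × Fin n) ⊎ Fin n)
    _≟ʰ_ = Sum.≡-dec (Product.≡-dec _≟_ _≟_) _≟_

    HAdj-respʳ : ∀ {x y y′} → hkey y ≡ hkey y′ → HAdj G W x y → HAdj G W x y′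
    HAdj-respʳ {inj₁ _} {inj₁ (p , _)} {inj₁ (.p , _)} refl adj = adj
    HAdj-respʳ {inj₂ _} {inj₁ (p , _)} {inj₁ (.p , _)} refl adj = adj
    HAdj-respʳ {inj₁ _} {inj₂ (a , _)} {inj₂ (.a , _)} refl adj = adj
    HAdj-respʳ {inj₂ _} {inj₂ _}       {inj₂ _}        _    ()
    HAdj-respʳ {y = inj₁ _} {inj₂ _} ()
    HAdj-respʳ {y = inj₂ _} {inj₁ _} ()

    At : Fin n → HV G W → Set
    At a (inj₁ e) = a ∈ᵉ e
    At a (inj₂ w) = proj₁ w ≡ a

    module _ (T : Subgraph G) where

      private
        TG : Graph
        TG = asGraph T

        Wₕ Sₜ : HV G W → Set
        Wₕ = WH {G = G} {W = W}
        Sₜ = VT∪WH {G = G} {W = W} T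

        HT : Graph
        HT = Induced (H G W) Sₜ

        terminal : ∀ {v} → v ∈ W → V HT
        terminal {v} v∈W = inj₂ (v , v∈W) , tt

      incident⇒TV : ∀ {a} (e : Edge G) → TE T e → a ∈ᵉ e → TV T a
      incident⇒TV e te (inj₁ refl) = proj₁ (closed T e te)
      incident⇒TV e te (inj₂ refl) = proj₂ (closed T e te)

      reachable-along-edge : ∀ {a c} (e : Edge G) → TE T e → a ∈ᵉ e → c ∈ᵉ e →
                             (ta : TV T a) → Σ (TV T c) λ tc → Reachable TG (a , ta) (c , tc)
      reachable-along-edge e te (inj₁ refl) (inj₁ refl) ta = ta , reachable-refl
      reachable-along-edge e te (inj₂ refl) (inj₂ refl) ta = ta , reachable-refl
      reachable-along-edge e te (inj₁ refl) (inj₂ refl) ta =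
        proj₂ (closed T e te) , _ , step (e , te , inj₁ refl) here
      reachable-along-edge e te (inj₂ refl) (inj₁ refl) ta =
        proj₁ (closed T e te) , _ , step (e , te , inj₂ refl) here

      step-T⇒H : ∀ {a b} (d : Edge G) → TE T d → a ∈ᵉ d → b ∈ᵉ d →
                 (X : V HT) → At a (proj₁ X) → Σ (V HT) λ Y → At b (proj₁ Y) × Reachable HT X Y
      step-T⇒H d td a∈d b∈d (inj₂ _ , _) refl = (inj₁ d , td) , b∈d , _ , step a∈d here
      step-T⇒H d td a∈d b∈d (inj₁ e , te) a∈e with Product.≡-dec _≟_ _≟_ (proj₁ e) (proj₁ d)
      ... | yes e≡d = (inj₁ e , te) , ∈ᵉ-resp d e (sym e≡d) b∈d , reachable-refl
      ... | no  e≢d = (inj₁ d , td) , b∈d , _ , step (e≢d , _ , a∈e , a∈d) here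

      walk-T⇒H : ∀ {x z vs} → Walk TG x z vs → (X : V HT) → At (proj₁ x) (proj₁ X) →
                 Σ (V HT) λ Z → At (proj₁ z) (proj₁ Z) × Reachable HT X Z
      walk-T⇒H here X at = X , at , reachable-refl
      walk-T⇒H (step (d , td , d≡xy) w) X at
        with step-T⇒H d td (proj₁ (ends-∈ᵉ d d≡xy)) (proj₂ (ends-∈ᵉ d d≡xy)) X at
      ... | Y , atY , X⇝Y with walk-T⇒H w Y atY
      ...   | Z , atZ , Y⇝Z = Z , atZ , reachable-trans X⇝Y Y⇝Z

      reachable-terminal : ∀ {v} (v∈W : v ∈ W) (X : V HT) → At v (proj₁ X) →
                           Reachable HT X (terminal v∈W)
      reachable-terminal v∈W (inj₁ e , _) v∈e = _ , step v∈e here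
      reachable-terminal v∈W (inj₂ (_ , w∈W) , _) refl rewrite []=-irrelevant w∈W v∈W =
        reachable-refl

      step-H⇒T : ∀ {a} (X Y : V HT) → Adj HT X Y → At a (proj₁ X) → (ta : TV T a) →
                 Σ (Fin n) λ c → At c (proj₁ Y) × Σ (TV T c) λ tc → Reachable TG (a , ta) (c , tc)
      step-H⇒T (inj₂ _ , _) (inj₁ _ , _) w∈f refl ta = _ , w∈f , ta , reachable-refl
      step-H⇒T (inj₁ e , te) (inj₁ _ , _) (_ , c , c∈e , c∈f) a∈e ta =
        c , c∈f , reachable-along-edge e te a∈e c∈e ta
      step-H⇒T (inj₁ e , te) (inj₂ _ , _) w∈e a∈e ta =
        _ , refl , reachable-along-edge e te a∈e w∈e ta
      step-H⇒T (inj₂ _ , _) (inj₂ _ , _) ()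

      walk-H⇒T : ∀ {X Z vs a} → Walk HT X Z vs → At a (proj₁ X) → (ta : TV T a) →
                 Σ (Fin n) λ c → At c (proj₁ Z) × Σ (TV T c) λ tc → Reachable TG (a , ta) (c , tc)
      walk-H⇒T here at ta = _ , at , ta , reachable-refl
      walk-H⇒T {X} (step {y = Y} adj w) at ta with step-H⇒T X Y adj at ta
      ... | b , atY , tb , a⇝b with walk-H⇒T w atY tb
      ...   | c , atZ , tc , b⇝c = c , atZ , tc , reachable-trans a⇝b b⇝c

      private
        TAdj-respʳ : ∀ {x y y′ : V TG} → proj₁ y ≡ proj₁ y′ → Adj TG x y → Adj TG x y′
        TAdj-respʳ {y = a , _} {y′ = .a , _} refl adj = adj

        module PathT = WalkToPath {TG} proj₁ _≟_ (λ {x} {y} {y′} → TAdj-respʳ {x} {y} {y′})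
        module PathH = WalkToPath {HT} (hkey ∘ proj₁) _≟ʰ_ HAdj-respʳ

      steiner⇒inducedSteiner : IsSteiner G W T → IsInducedSteiner (H G W) Wₕ Sₜ
      steiner⇒inducedSteiner steiner (inj₂ (u , u∈W)) (inj₂ (v , v∈W)) _ _ u′≢v′
        with steiner u v u∈W v∈W u≢v
        where
          u≢v : ¬ u ≡ v
          u≢v refl = u′≢v′ (cong (λ p → inj₂ (u , p)) ([]=-irrelevant u∈W v∈W))
      ... | _ , _ , _ , u⇝v , _ with walk-T⇒H u⇝v (terminal u∈W) refl
      ...   | Z , atZ , u′⇝Z with reachable-trans u′⇝Z (reachable-terminal v∈W Z atZ)
      ...     | _ , u′⇝v′ with PathH.walk⇒path u′⇝v′
      ...       | (inj₂ (.u , u∈W′) , tt) , refl , path rewrite []=-irrelevant u∈W′ u∈W =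
                  tt , tt , path

      inducedSteiner⇒steiner : IsInducedSteiner (H G W) Wₕ Sₜ → IsSteiner G W T
      inducedSteiner⇒steiner ist u v u∈W v∈W u≢v
        with ist (inj₂ (u , u∈W)) (inj₂ (v , v∈W)) tt tt (λ { refl → u≢v refl })
      ... | tt , tt , _ , here , _ = ⊥-elim (u≢v refl)
      ... | tt , tt , _ , u′⇝v′@(step {y = inj₁ e , te} u∈e _) , _
        with walk-H⇒T u′⇝v′ refl (incident⇒TV e te u∈e)
      ...   | .v , refl , tv , _ , u⇝v with PathT.walk⇒path u⇝v
      ...     | (.u , tu) , refl , path = tu , tv , path

theorem7p1 : ∀ {n} (G : SimpleGraph n) (W : Subset n) (T : Subgraph G) →
    IsSteiner G W T ⇔ IsInducedSteiner (H G W) (WH {G = G} {W = W}) (VT∪WH {G = G} {W = W} T)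
theorem7p1 G W T = mk⇔ (steiner⇒inducedSteiner G W T) (inducedSteiner⇒steiner G W T)
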